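{- (Internal completeness, negative case) Let $\alpha=(z_1,\dots,z_n,\alpha_0)$ be a logical connective, $\mathbf{P}_1,\dots,\mathbf{P}_n$ positive behaviours, and $N=\sum a(\vec x).P_a$ an atomic negative design. Then $N\in\alpha(\mathbf{P}_1,\dots,\mathbf{P}_n)$ if and only if for every $a(\vec x)\in\alpha_0$, writing $\vec x=z_{i_1},\dots,z_{i_m}$, we have $P_a\models z_{i_1}:\mathbf{P}_{i_1},\dots,z_{i_m}:\mathbf{P}_{i_m}$.
   Context: Fix a signature (names $A$ with arities $\mathsf{ar}$) and a countable set of variables. Designs are possibly infinite terms coinductively generated by: positive $P ::= \Omega \mid \bigwedge\{S_i : i\in I\}$ ($I$ arbitrary); predesigns $S ::= N_0\,|\,\overline{a}\langle N_1,\dots,N_n\rangle$ ($\mathsf{ar}(a)=n$); negative $N ::= x \mid \sum a(\vec x).P_a$ (one component $a(\vec x).P_a$ for each $a\in A$, $\vec x$ distinct bound variables of length $\mathsf{ar}(a)$); up to $\alpha$-renaming and set-like treatment of conjunctions, $\bigwedge\{S\}=S$, $\maltese:=\bigwedge\emptyset$. Reduction: $P\rightsquigarrow Q$ iff $P$ has a conjunct $(\sum a(\vec x).P_a)\,|\,\overline b\langle\vec N\rangle$ and $Q=P_b[\vec N/\vec x]$. Normal form (corecursive): $[\![P]\!]=\Omega$ if some reduction sequence from $P$ is infinite or ends in $\Omega$; otherwise $[\![P]\!]$ is the conjunction of all $x\,|\,\overline a\langle[\![\vec N]\!]\rangle$ with $x|\overline a\langle\vec N\rangle$ a conjunct of some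 $Q$, $P\rightsquigarrow^*Q$; $[\![\sum a(\vec x).P_a]\!]=\sum a(\vec x).[\![P_a]\!]$, $[\![x]\!]=x$. Standard design: $\neq\Omega$ and generated by $P::=\Omega\mid\bigwedge\{S_i\}$, $S::=x\,|\,\overline a\langle N_1,\dots,N_n\rangle$, $N::=\sum a(\vec x).P_a$. Atomic positive: standard with free variables among a fixed variable $x_0$; atomic negative: standard and closed. $P\perp N$ iff $[\![P[N/x_0]]\!]=\maltese$; $\mathbf{X}^\perp$ = atomic designs of opposite polarity orthogonal to every element of $\mathbf{X}$; a behaviour is a set $\mathbf{X}$ of atomic designs of one polarity with $\mathbf{X}^{\perp\perp}=\mathbf{X}$. For a positive context $y_1:\mathbf{Q}_1,\dots,y_k:\mathbf{Q}_k$ (distinct variables, positive behaviours), $P\models y_1:\mathbf{Q}_1,\dots,y_k:\mathbf{Q}_k$ means $P$ is standard, $\mathsf{fv}(P)\subseteq\{y_1,\dots,y_k\}$, and $[\![P[K_1/y_1,\dots,K_k/y_k]]\!]=\maltese$ for all $K_j\in\mathbf{Q}_j^\perp$. An $n$-ary logical connective is $\alpha=(z_1,\dots,z_n,\alpha_0)$ with $z_i$ distinct variables and $\alpha_0$ a finite set of negative actions $a(\vec x)$ ($a\in A$, $\vec x$ a list of $\mathsf{ar}(a)$ distinct variables among $z_1,\dots,z_n$) with pairwise distinct names. For negative behaviours, $\overline a\langle\mathbf N_1,\dots,\mathbf N_m\rangle:=\{x_0\,|\,\overline a\langle N_1,\dots,N_m\rangle : N_j\in\mathbf N_j\}$, $\overline\alpha\langle\mathbf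 N_1,\dots,\mathbf N_n\rangle:=\big(\bigcup_{a(\vec x)\in\alpha_0}\overline a\langle\mathbf N_{i_1},\dots,\mathbf N_{i_m}\rangle\big)^{\perp\perp}$ where $\vec x=z_{i_1},\dots,z_{i_m}$, and for positive behaviours $\alpha(\mathbf P_1,\dots,\mathbf P_n):=\overline\alpha\langle\mathbf P_1^\perp,\dots,\mathbf P_n^\perp\rangle^\perp$. -}

module Defs where

open import Level using (Level; _⊔_; 0ℓ) renaming (suc to lsuc)
open import Data.Nat using (ℕ; zero; suc; _+_)
open import Data.Fin using (Fin; zero; suc; splitAt; _↑ˡ_; _↑ʳ_)
open import Data.Sum using (_⊎_; inj₁; inj₂)
open import Data.Maybe using (Maybe; just; nothing)
open import Data.Unit using (⊤; tt)
open import Data.Empty using (⊥)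
open import Data.Product using (Σ; _×_; _,_)
open import Data.List using (List; map)
open import Data.List.Membership.Propositional using (_∈_)
open import Data.List.Relation.Unary.Unique.Propositional using (Unique)
open import Function using (id; _∘_; _⇔_)
open import Function.Definitions using (Injective)
open import Relation.Binary.PropositionalEquality using (_≡_; refl)
open import Relation.Nullary using (¬_)

record Signature : Set₁ where
  field
    Name : Set
    ar   : Name → ℕ

module Ludics (Sg : Signature) where
  open Signature Sg

  -- Scoping is de Bruijn style: a design of scope n has its free variables
  -- among Fin n.  In a component a(x⃗).P_a of a negative design of scope n,
  -- the body P_a has scope n + ar a: the variables (i ↑ˡ ar a) are the
  -- free variables of the sum, the variables (n ↑ʳ j) are the bound x⃗.
  data PosL {ℓ} (R : ℕ → Set ℓ) (n : ℕ) : Set (lsuc 0ℓ ⊔ ℓ) where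
    Ω : PosL R n
    ⋀ : (I : Set) → (I → R n) → PosL R n

  data PreL {ℓ} (N : ℕ → Set ℓ) (n : ℕ) : Set ℓ where
    cut : N n → (b : Name) → (Fin (ar b) → N n) → PreL N n

  data NegL {ℓ} (P : ℕ → Set ℓ) (n : ℕ) : Set ℓ where
    var : Fin n → NegL P n
    sum : ((a : Name) → P (n + ar a)) → NegL P n

  mapPosL : ∀ {ℓ ℓ'} {R : ℕ → Set ℓ} {R' : ℕ → Set ℓ'} {n m} →
            (R n → R' m) → PosL R n → PosL R' m
  mapPosL g Ω = Ω
  mapPosL g (⋀ I S) = ⋀ I (λ i → g (S i))

  mapPreL : ∀ {ℓ ℓ'} {N : ℕ → Set ℓ} {N' : ℕ → Set ℓ'} {n m} →
            (N n → N' m) → PreL N n → PreL N' m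
  mapPreL g (cut h b Ns) = cut (g h) b (λ j → g (Ns j))

  mapNegL : ∀ {ℓ ℓ'} {P : ℕ → Set ℓ} {P' : ℕ → Set ℓ'} {n m} →
            (Fin n → Fin m) → (∀ a → P (n + ar a) → P' (m + ar a)) →
            NegL P n → NegL P' m
  mapNegL ρ g (var x) = var (ρ x)
  mapNegL ρ g (sum f) = sum (λ a → g a (f a))

  -- Possibly infinite designs, without coinductive types: a design is a
  -- state of a coalgebra for the above layer functor (a pointed coalgebra),
  -- i.e. it is presented by its unfolding.  Two presentations with the same
  -- unfolding (bisimilar) denote the same design; all notions below only
  -- depend on the unfolding.
  record Coalg : Set₁ where
    field
      PS RS NS : ℕ → Set
      pobs : ∀ {n} → PS n → PosL RS n
      robs : ∀ {n} → RS n → PreL NS n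
      nobs : ∀ {n} → NS n → NegL PS n

  open Coalg

  record Pos (n : ℕ) : Set₁ where
    constructor pos
    field
      co : Coalg
      st : PS co n

  record Pre (n : ℕ) : Set₁ where
    constructor pre
    field
      co : Coalg
      st : RS co n

  record Neg (n : ℕ) : Set₁ where
    constructor neg
    field
      co : Coalg
      st : NS co n

  posView : ∀ {n} → Pos n → PosL Pre n
  posView (pos C p) = mapPosL (pre C) (pobs C p)

  preView : ∀ {n} → Pre n → PreL Neg n
  preView (pre C r) = mapPreL (neg C) (robs C r)

  negView : ∀ {n} → Neg n → NegL Pos n
  negView (neg C s) = mapNegL id (λ a → pos C) (nobs C s)

  SumCo : (J : Set) → (J → Coalg) → Coalg
  SumCo J Cs = record
    { PS = λ n → Σ J (λ j → PS (Cs j) n)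
    ; RS = λ n → Σ J (λ j → RS (Cs j) n)
    ; NS = λ n → Σ J (λ j → NS (Cs j) n)
    ; pobs = λ { (j , p) → mapPosL (j ,_) (pobs (Cs j) p) }
    ; robs = λ { (j , r) → mapPreL (j ,_) (robs (Cs j) r) }
    ; nobs = λ { (j , s) → mapNegL id (λ a → j ,_) (nobs (Cs j) s) }
    }

  RootP : (D : Coalg) (n : ℕ) → PosL (RS D) n → Coalg
  RootP D n l = record
    { PS = λ m → (m ≡ n) ⊎ PS D m
    ; RS = RS D
    ; NS = NS D
    ; pobs = λ { (inj₁ refl) → l ; (inj₂ p) → pobs D p }
    ; robs = robs D
    ; nobs = λ s → mapNegL id (λ a → inj₂) (nobs D s)
    }

  RootR : (D : Coalg) (n : ℕ) → PreL (NS D) n → Coalg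
  RootR D n l = record
    { PS = PS D
    ; RS = λ m → (m ≡ n) ⊎ RS D m
    ; NS = NS D
    ; pobs = λ p → mapPosL inj₂ (pobs D p)
    ; robs = λ { (inj₁ refl) → l ; (inj₂ r) → robs D r }
    ; nobs = nobs D
    }

  RootN : (D : Coalg) (n : ℕ) → NegL (PS D) n → Coalg
  RootN D n l = record
    { PS = PS D
    ; RS = RS D
    ; NS = λ m → (m ≡ n) ⊎ NS D m
    ; pobs = pobs D
    ; robs = λ r → mapPreL inj₂ (robs D r)
    ; nobs = λ { (inj₁ refl) → l ; (inj₂ s) → nobs D s }
    }

  consPos : ∀ {n} → PosL Pre n → Pos n
  consPos {n} Ω = pos (RootP (SumCo ⊥ (λ ())) n Ω) (inj₁ refl)
  consPos {n} (⋀ I S) =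
    pos (RootP (SumCo I (Pre.co ∘ S)) n (⋀ I (λ i → i , Pre.st (S i)))) (inj₁ refl)

  private
    preFam : ∀ {n} (h : Neg n) (b : Name) → (Fin (ar b) → Neg n) →
             Maybe (Fin (ar b)) → Coalg
    preFam h b Ns nothing  = Neg.co h
    preFam h b Ns (just j) = Neg.co (Ns j)

  consPre : ∀ {n} → PreL Neg n → Pre n
  consPre {n} (cut h b Ns) =
    pre (RootR (SumCo (Maybe (Fin (ar b))) (preFam h b Ns)) n
               (cut (nothing , Neg.st h) b (λ j → just j , Neg.st (Ns j))))
        (inj₁ refl)

  consNeg : ∀ {n} → NegL Pos n → Neg n
  consNeg {n} (var x) = neg (RootN (SumCo ⊥ (λ ())) n (var x)) (inj₁ refl)
  consNeg {n} (sum f) =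
    neg (RootN (SumCo Name (λ a → Pos.co (f a))) n (sum (λ a → a , Pos.st (f a))))
        (inj₁ refl)

  varN : ∀ {n} → Fin n → Neg n
  varN x = consNeg (var x)

  liftRen : ∀ {k m} j → (Fin k → Fin m) → Fin (k + j) → Fin (m + j)
  liftRen {k} {m} j ρ i with splitAt k i
  ... | inj₁ x = ρ x ↑ˡ j
  ... | inj₂ y = m ↑ʳ y

  -- Renamed states of D, plus variable states.
  VRV : Coalg → Coalg
  VRV D = record
    { PS = λ m → Σ ℕ (λ k → PS D k × (Fin k → Fin m))
    ; RS = λ m → Σ ℕ (λ k → RS D k × (Fin k → Fin m))
    ; NS = λ m → Σ ℕ (λ k → NS D k × (Fin k → Fin m)) ⊎ Fin m
    ; pobs = λ { (k , p , ρ) → mapPosL (λ r → k , r , ρ) (pobs D p) }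
    ; robs = λ { (k , r , ρ) → mapPreL (λ s → inj₁ (k , s , ρ)) (robs D r) }
    ; nobs = λ { (inj₁ (k , s , ρ)) →
                   mapNegL ρ (λ a p → k + ar a , p , liftRen (ar a) ρ) (nobs D s)
               ; (inj₂ x) → var x }
    }

  wkV : ∀ {D : Coalg} {m} j → NS (VRV D) m → NS (VRV D) (m + j)
  wkV j (inj₁ (k , s , ρ)) = inj₁ (k , s , (λ x → ρ x ↑ˡ j))
  wkV j (inj₂ x) = inj₂ (x ↑ˡ j)

  liftσ : ∀ {D : Coalg} {k m} j → (Fin k → NS (VRV D) m) →
          Fin (k + j) → NS (VRV D) (m + j)
  liftσ {D} {k} {m} j σ i with splitAt k i
  ... | inj₁ x = wkV {D} j (σ x)
  ... | inj₂ y = inj₂ (m ↑ʳ y)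

  -- States of C with a pending substitution into (renamed) states of D.
  module _ (C D : Coalg) where
    private
      E = VRV D
      Clo : (ℕ → Set) → ℕ → Set
      Clo F m = Σ ℕ (λ k → F k × (Fin k → NS E m))

      PS′ RS′ NS′ : ℕ → Set
      PS′ m = Clo (PS C) m ⊎ PS E m
      RS′ m = Clo (RS C) m ⊎ RS E m
      NS′ m = Clo (NS C) m ⊎ NS E m

      pobs′ : ∀ {m} → PS′ m → PosL RS′ m
      pobs′ (inj₁ (k , p , σ)) = mapPosL (λ r → inj₁ (k , r , σ)) (pobs C p)
      pobs′ (inj₂ e) = mapPosL inj₂ (pobs E e)

      robs′ : ∀ {m} → RS′ m → PreL NS′ m
      robs′ (inj₁ (k , r , σ)) = mapPreL (λ s → inj₁ (k , s , σ)) (robs C r)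
      robs′ (inj₂ e) = mapPreL inj₂ (robs E e)

      subNegL : ∀ {k m} → (Fin k → NS E m) → NegL (PS C) k → NegL PS′ m
      subNegL σ (var x) = mapNegL id (λ a → inj₂) (nobs E (σ x))
      subNegL {k} σ (sum f) = sum (λ a → inj₁ (k + ar a , f a , liftσ {D} (ar a) σ))

      nobs′ : ∀ {m} → NS′ m → NegL PS′ m
      nobs′ (inj₁ (k , s , σ)) = subNegL σ (nobs C s)
      nobs′ (inj₂ e) = mapNegL id (λ a → inj₂) (nobs E e)

    SubCo : Coalg
    SubCo = record
      { PS = PS′ ; RS = RS′ ; NS = NS′ ; pobs = pobs′ ; robs = robs′ ; nobs = nobs′ }

  renNeg : ∀ {k m} → (Fin k → Fin m) → Neg k → Neg m
  renNeg {k} ρ (neg C s) = neg (VRV C) (inj₁ (k , s , ρ))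

  subPos : ∀ {k m} → (Fin k → Neg m) → Pos k → Pos m
  subPos {k} {m} σ (pos C p) =
    pos (SubCo C (SumCo (Fin k) (λ i → Neg.co (σ i))))
        (inj₁ (k , p , λ i → inj₁ (m , (i , Neg.st (σ i)) , id)))

  instEnv : ∀ {n} (b : Name) → (Fin (ar b) → Neg n) → Fin (n + ar b) → Neg n
  instEnv {n} b Ns i with splitAt n i
  ... | inj₁ x = varN x
  ... | inj₂ j = Ns j

  -- Reduction: P ⇝ Q iff P has a conjunct (Σ a(x⃗).P_a) | b̄⟨N⃗⟩ and
  -- Q = P_b[N⃗/x⃗].  [[P]] = ✠ iff no reduction sequence from P is infinite
  -- or ends in Ω, and no Q with P ⇝* Q has a conjunct x | ā⟨N⃗⟩.  This is
  -- the inductive (well-founded reduction tree) predicate below.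
  mutual
    data NF✠ {n : ℕ} : Pos n → Set₁ where
      nf✠ : ∀ {P : Pos n} {I : Set} {S : I → Pre n} →
            posView P ≡ ⋀ I S → (∀ i → NF✠Pre (S i)) → NF✠ P

    data NF✠Pre {n : ℕ} : Pre n → Set₁ where
      nf✠cut : ∀ {T : Pre n} {h : Neg n} {b : Name} {Ns : Fin (ar b) → Neg n}
                 {f : (a : Name) → Pos (n + ar a)} →
               preView T ≡ cut h b Ns → negView h ≡ sum f →
               NF✠ (subPos (instEnv b Ns) (f b)) → NF✠Pre T

  -- Standard designs: ≠ Ω and generated (coinductively) by
  --   P ::= Ω | ⋀{S_i},  S ::= x | ā⟨N⃗⟩,  N ::= Σ a(x⃗).P_a .
  -- The coinductive predicate is given as the greatest fixed point: there is
  -- an invariant on the states of the coalgebra, closed under the grammar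
  -- rules, containing the design.
  IsVarL : ∀ {ℓ} {P : ℕ → Set ℓ} {n} → NegL P n → Set
  IsVarL (var _) = ⊤
  IsVarL (sum _) = ⊥

  IsΩL : ∀ {ℓ} {R : ℕ → Set ℓ} {n} → PosL R n → Set
  IsΩL Ω = ⊤
  IsΩL (⋀ _ _) = ⊥

  module _ (C : Coalg) where
    PosOK : (∀ {n} → RS C n → Set) → ∀ {n} → PosL (RS C) n → Set
    PosOK Ir Ω = ⊤
    PosOK Ir (⋀ I S) = ∀ i → Ir (S i)

    PreOK : (∀ {n} → NS C n → Set) → ∀ {n} → PreL (NS C) n → Set
    PreOK In (cut h b Ns) = IsVarL (nobs C h) × (∀ j → In (Ns j))

    NegOK : (∀ {n} → PS C n → Set) → ∀ {n} → NegL (PS C) n → Set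
    NegOK Ip (var _) = ⊥
    NegOK Ip (sum f) = ∀ a → Ip (f a)

    record GenInv : Set₁ where
      field
        Ip : ∀ {n} → PS C n → Set
        Ir : ∀ {n} → RS C n → Set
        In : ∀ {n} → NS C n → Set
        closedP : ∀ {n} {p : PS C n} → Ip p → PosOK Ir (pobs C p)
        closedR : ∀ {n} {r : RS C n} → Ir r → PreOK In (robs C r)
        closedN : ∀ {n} {s : NS C n} → In s → NegOK Ip (nobs C s)

  GenPos : ∀ {n} → Pos n → Set₁
  GenPos (pos C p) = Σ (GenInv C) (λ inv → GenInv.Ip inv p)

  GenNeg : ∀ {n} → Neg n → Set₁
  GenNeg (neg C s) = Σ (GenInv C) (λ inv → GenInv.In inv s)

  StandardPos : ∀ {n} → Pos n → Set₁
  StandardPos P = (¬ IsΩL (posView P)) × GenPos P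

  StandardNeg : ∀ {n} → Neg n → Set₁
  StandardNeg N = GenNeg N

  -- Atomic designs: positive ones have free variables among x₀ (scope 1,
  -- x₀ = zero); negative ones are closed (scope 0).
  AtomicPos : Pos 1 → Set₁
  AtomicPos = StandardPos

  AtomicNeg : Neg 0 → Set₁
  AtomicNeg = StandardNeg

  x₀ : Fin 1
  x₀ = zero

  _⊥ᴰ_ : Pos 1 → Neg 0 → Set₁
  P ⊥ᴰ N = NF✠ (subPos (λ _ → N) P)

  PSet : Set₂
  PSet = Pos 1 → Set₁

  NSet : Set₂
  NSet = Neg 0 → Set₁

  _^⊥ₚ : PSet → NSet
  (X ^⊥ₚ) N = AtomicNeg N × (∀ P → X P → P ⊥ᴰ N)

  _^⊥ₙ : NSet → PSet
  (X ^⊥ₙ) P = AtomicPos P × (∀ N → X N → P ⊥ᴰ N)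

  IsPosBehaviour : PSet → Set₁
  IsPosBehaviour X = ∀ P → ((X ^⊥ₚ) ^⊥ₙ) P ⇔ X P

  IsNegBehaviour : NSet → Set₁
  IsNegBehaviour X = ∀ N → ((X ^⊥ₙ) ^⊥ₚ) N ⇔ X N

  _⊨_ : ∀ {k} → Pos k → (Fin k → PSet) → Set₁
  _⊨_ {k} P Qs = StandardPos P ×
    (∀ (Ks : Fin k → Neg 0) → (∀ j → (Qs j ^⊥ₚ) (Ks j)) → NF✠ (subPos Ks P))

  -- Logical connectives.  The variables z₁,…,z_n are represented by Fin n;
  -- an action a(x⃗) with x⃗ = z_{i₁},…,z_{i_m} is a name a together with an
  -- injective map Fin (ar a) → Fin n (j ↦ i_j).
  record Action (n : ℕ) : Set where
    constructor act
    field
      name     : Name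
      args     : Fin (ar name) → Fin n
      args-inj : Injective _≡_ _≡_ args

  record Connective : Set where
    field
      arity    : ℕ
      actions  : List (Action arity)
      distinct : Unique (map Action.name actions)

  headAt : (a : Name) → (Fin (ar a) → Neg 0) → Pos 1
  headAt a Ns = consPos (⋀ ⊤ (λ _ → consPre (cut (varN x₀) a (λ j → renNeg (λ ()) (Ns j)))))

  unionα : (α : Connective) → (Fin (Connective.arity α) → NSet) → PSet
  unionα α Nb P =
    Σ (Action (Connective.arity α)) λ ac →
      (ac ∈ Connective.actions α) ×
      Σ (Fin (ar (Action.name ac)) → Neg 0) λ Ns →
        (∀ j → Nb (Action.args ac j) (Ns j)) × (P ≡ headAt (Action.name ac) Ns)

  α̅⟨_⟩ : (α : Connective) → (Fin (Connective.arity α) → NSet) → PSet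
  α̅⟨ α ⟩ Nb = ((unionα α Nb) ^⊥ₚ) ^⊥ₙ

  α⟪_⟫ : (α : Connective) → (Fin (Connective.arity α) → PSet) → NSet
  α⟪ α ⟫ Pb = (α̅⟨ α ⟩ (λ i → (Pb i) ^⊥ₚ)) ^⊥ₚ

module Submission where

-- For atomic
-- N = Σ a(x⃗).P_a, since α(P⃗) = (∪ ā⟨P⃗^⊥⟩)^⊥⊥⊥ = (∪ ā⟨P⃗^⊥⟩)^⊥, the theorem is
--  (1) x₀ | ā⟨K⃗⟩ ⊥ N iff [[P_a[K⃗/x⃗]]] = ✠ (one reduction step), read
--      componentwise, together with
--  (2) the P_a are standard, and x₀ | ā⟨K⃗⟩ is atomic when the K_j are, and
--  (3) the daimon Σ a(x⃗).✠ lies in Q^⊥ for every positive behaviour Q;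
--      testing P_a against it shows P_a ≠ Ω.
-- Designs are states of coalgebras, so the reduct in (1) is P_a[K⃗/x⃗] only
-- up to bisimilarity.

open import Defs
open import Level using (0ℓ; _⊔_) renaming (suc to lsuc)
open import Data.Nat using (ℕ; _+_)
open import Data.Fin using (Fin; zero; splitAt; _↑ˡ_)
open import Data.Fin.Properties using (splitAt-↑ˡ; splitAt-↑ʳ; splitAt⁻¹-↑ˡ; splitAt⁻¹-↑ʳ)
open import Data.Sum using (_⊎_; inj₁; inj₂)
open import Data.Maybe using (just; nothing)
open import Data.Unit using (⊤; tt)
open import Data.Empty using (⊥; ⊥-elim)
open import Data.Product using (Σ; _×_; _,_; proj₁; proj₂)
open import Data.List.Membership.Propositional using (_∈_)
open import Function using (_⇔_; mk⇔; Equivalence)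
open import Function.Properties.Equivalence using () renaming (trans to ⇔-trans)
open import Relation.Binary.PropositionalEquality using (_≡_; refl; sym; trans; cong; subst)
open import Relation.Nullary using (¬_)

module Layers (Sg : Signature) where
  open Signature Sg
  open Ludics Sg

  data PosLR {a b r} {R : ℕ → Set a} {R' : ℕ → Set b}
             (Rel : ∀ {n} → R n → R' n → Set r) {n : ℕ} :
             PosL R n → PosL R' n → Set (lsuc 0ℓ ⊔ a ⊔ b ⊔ r) where
    Ωr : PosLR Rel Ω Ω
    ⋀r : ∀ {I S S'} → (∀ i → Rel (S i) (S' i)) → PosLR Rel (⋀ I S) (⋀ I S')

  data PreLR {a b r} {R : ℕ → Set a} {R' : ℕ → Set b}
             (Rel : ∀ {n} → R n → R' n → Set r) {n : ℕ} :
             PreL R n → PreL R' n → Set (a ⊔ b ⊔ r) where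
    cutr : ∀ {h h' c Ns Ns'} → Rel h h' → (∀ j → Rel (Ns j) (Ns' j)) →
           PreLR Rel (cut h c Ns) (cut h' c Ns')

  data NegLR {a b r} {R : ℕ → Set a} {R' : ℕ → Set b}
             (Rel : ∀ {n} → R n → R' n → Set r) {n : ℕ} :
             NegL R n → NegL R' n → Set (a ⊔ b ⊔ r) where
    varr : ∀ {x} → NegLR Rel (var x) (var x)
    sumr : ∀ {f g} → (∀ c → Rel (f c) (g c)) → NegLR Rel (sum f) (sum g)

  module _ {a b a' b' r r'} {R : ℕ → Set a} {R' : ℕ → Set b}
           {T : ℕ → Set a'} {T' : ℕ → Set b'}
           {Rel : ∀ {n} → R n → R' n → Set r} {Rel' : ∀ {n} → T n → T' n → Set r'} where
    mapPosLR : ∀ {n m} {g : R n → T m} {g' : R' n → T' m} →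
               (∀ {x y} → Rel x y → Rel' (g x) (g' y)) →
               ∀ {l l'} → PosLR Rel l l' → PosLR Rel' (mapPosL {R = R} {R' = T} g l) (mapPosL {R = R'} {R' = T'} g' l')
    mapPosLR gg Ωr = Ωr
    mapPosLR gg (⋀r rs) = ⋀r (λ i → gg (rs i))

    mapPreLR : ∀ {n m} {g : R n → T m} {g' : R' n → T' m} →
               (∀ {x y} → Rel x y → Rel' (g x) (g' y)) →
               ∀ {l l'} → PreLR Rel l l' → PreLR Rel' (mapPreL {N = R} {N' = T} g l) (mapPreL {N = R'} {N' = T'} g' l')
    mapPreLR gg (cutr h ns) = cutr (gg h) (λ j → gg (ns j))

    mapNegLR : ∀ {n m} {ρ ρ' : Fin n → Fin m}
               {g : ∀ c → R (n + ar c) → T (m + ar c)} {g' : ∀ c → R' (n + ar c) → T' (m + ar c)} →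
               (∀ x → ρ x ≡ ρ' x) → (∀ c {x y} → Rel x y → Rel' (g c x) (g' c y)) →
               ∀ {l l'} → NegLR Rel l l' → NegLR Rel' (mapNegL {P = R} {P' = T} ρ g l) (mapNegL {P = R'} {P' = T'} ρ' g' l')
    mapNegLR {ρ = ρ} eρ gg (varr {x}) rewrite eρ x = varr
    mapNegLR eρ gg (sumr fs) = sumr (λ c → gg c (fs c))

  module _ {a b r} {R : ℕ → Set a} {T : ℕ → Set b} {Rel : ∀ {n} → T n → R n → Set r} where
    graphPosL : ∀ {n} {g : R n → T n} → (∀ x → Rel (g x) x) → (l : PosL R n) →
                PosLR Rel (mapPosL {R = R} {R' = T} g l) l
    graphPosL gg Ω = Ωr
    graphPosL gg (⋀ I S) = ⋀r (λ i → gg (S i))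

    graphPreL : ∀ {n} {g : R n → T n} → (∀ x → Rel (g x) x) → (l : PreL R n) →
                PreLR Rel (mapPreL {N = R} {N' = T} g l) l
    graphPreL gg (cut h b Ns) = cutr (gg h) (λ j → gg (Ns j))

    graphNegL : ∀ {n} {ρ : Fin n → Fin n} {g : ∀ c → R (n + ar c) → T (n + ar c)} →
                (∀ x → ρ x ≡ x) → (∀ c x → Rel (g c x) x) → (l : NegL R n) →
                NegLR Rel (mapNegL {P = R} {P' = T} ρ g l) l
    graphNegL e gg (var x) rewrite e x = varr
    graphNegL e gg (sum f) = sumr (λ c → gg c (f c))

  module _ {a} {R : ℕ → Set a} where
    mapPosL-id : ∀ {n} (l : PosL R n) → l ≡ mapPosL {R = R} {R' = R} (λ x → x) l
    mapPosL-id Ω = refl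
    mapPosL-id (⋀ I S) = refl

    mapPreL-id : ∀ {n} (l : PreL R n) → l ≡ mapPreL {N = R} {N' = R} (λ x → x) l
    mapPreL-id (cut h b Ns) = refl

    mapNegL-id : ∀ {n} (l : NegL R n) → l ≡ mapNegL {P = R} {P' = R} (λ x → x) (λ c x → x) l
    mapNegL-id (var x) = refl
    mapNegL-id (sum f) = refl

  module _ {a b r} {R : ℕ → Set a} {R' : ℕ → Set b} {Rel : ∀ {n} → R n → R' n → Set r} {n : ℕ} where
    inv⋀ : ∀ {I : Set} {S : I → R n} {l : PosL R' n} → PosLR Rel (⋀ I S) l →
           Σ (I → R' n) λ S' → (l ≡ ⋀ I S') × (∀ i → Rel (S i) (S' i))
    inv⋀ (⋀r rs) = _ , refl , rs

    invCut : ∀ {h : R n} {c : Name} {Ns : Fin (ar c) → R n} {l : PreL R' n} → PreLR Rel (cut h c Ns) l →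
             Σ (R' n) λ h' → Σ (Fin (ar c) → R' n) λ Ns' →
               (l ≡ cut h' c Ns') × Rel h h' × (∀ j → Rel (Ns j) (Ns' j))
    invCut (cutr hh ns) = _ , _ , refl , hh , ns

    invSum : ∀ {f : (c : Name) → R (n + ar c)} {l : NegL R' n} → NegLR Rel (sum f) l →
             Σ ((c : Name) → R' (n + ar c)) λ f' → (l ≡ sum f') × (∀ c → Rel (f c) (f' c))
    invSum (sumr fs) = _ , refl , fs

  module _ {a b r} {R : ℕ → Set a} {R' : ℕ → Set b} {Rel : ∀ {n} → R n → R' n → Set r} where
    PosLR-sym : ∀ {n} {l l'} → PosLR {R = R} {R' = R'} Rel {n} l l' → PosLR (λ x y → Rel y x) l' l
    PosLR-sym Ωr = Ωr
    PosLR-sym (⋀r rs) = ⋀r rs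

    PreLR-sym : ∀ {n} {l l'} → PreLR {R = R} {R' = R'} Rel {n} l l' → PreLR (λ x y → Rel y x) l' l
    PreLR-sym (cutr h ns) = cutr h ns

    NegLR-sym : ∀ {n} {l l'} → NegLR {R = R} {R' = R'} Rel {n} l l' → NegLR (λ x y → Rel y x) l' l
    NegLR-sym varr = varr
    NegLR-sym (sumr fs) = sumr fs

  module _ {R₁ R₂ R₃ : ℕ → Set} {A : ∀ {n} → R₁ n → R₂ n → Set} {B : ∀ {n} → R₂ n → R₃ n → Set} where
    Comp : ∀ {n} → R₁ n → R₃ n → Set
    Comp {n} x z = Σ (R₂ n) λ y → A x y × B y z

    PosLR-trans : ∀ {n} {l l' l''} → PosLR {R = R₁} {R' = R₂} A {n} l l' → PosLR B l' l'' → PosLR Comp l l''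
    PosLR-trans Ωr Ωr = Ωr
    PosLR-trans (⋀r rs) (⋀r ss) = ⋀r (λ i → _ , rs i , ss i)

    PreLR-trans : ∀ {n} {l l' l''} → PreLR {R = R₁} {R' = R₂} A {n} l l' → PreLR B l' l'' → PreLR Comp l l''
    PreLR-trans (cutr h ns) (cutr h' ns') = cutr (_ , h , h') (λ j → _ , ns j , ns' j)

    NegLR-trans : ∀ {n} {l l' l''} → NegLR {R = R₁} {R' = R₂} A {n} l l' → NegLR B l' l'' → NegLR Comp l l''
    NegLR-trans varr varr = varr
    NegLR-trans (sumr fs) (sumr gs) = sumr (λ c → _ , fs c , gs c)

module Bisimilarity (Sg : Signature) where
  open Signature Sg
  open Ludics Sg
  open Coalg
  open Layers Sg

  record Bisim (C D : Coalg) : Set₁ where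
    field
      RP : ∀ {n} → PS C n → PS D n → Set
      RR : ∀ {n} → RS C n → RS D n → Set
      RN : ∀ {n} → NS C n → NS D n → Set
      bP : ∀ {n} {p q} → RP {n} p q → PosLR RR (pobs C p) (pobs D q)
      bR : ∀ {n} {p q} → RR {n} p q → PreLR RN (robs C p) (robs D q)
      bN : ∀ {n} {p q} → RN {n} p q → NegLR RP (nobs C p) (nobs D q)
  open Bisim public

  _≈P_ : ∀ {n} → Pos n → Pos n → Set₁
  P ≈P Q = Σ (Bisim (Pos.co P) (Pos.co Q)) λ B → RP B (Pos.st P) (Pos.st Q)

  _≈R_ : ∀ {n} → Pre n → Pre n → Set₁
  P ≈R Q = Σ (Bisim (Pre.co P) (Pre.co Q)) λ B → RR B (Pre.st P) (Pre.st Q)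

  _≈N_ : ∀ {n} → Neg n → Neg n → Set₁
  P ≈N Q = Σ (Bisim (Neg.co P) (Neg.co Q)) λ B → RN B (Neg.st P) (Neg.st Q)

  viewP : ∀ {n} {P Q : Pos n} → P ≈P Q → PosLR _≈R_ (posView P) (posView Q)
  viewP {n} {P} {Q} (B , r) =
    mapPosLR {Rel = RR B} {Rel' = _≈R_} {n = n} {m = n} {g = pre (Pos.co P)} {pre (Pos.co Q)} (B ,_) (bP B r)

  viewR : ∀ {n} {P Q : Pre n} → P ≈R Q → PreLR _≈N_ (preView P) (preView Q)
  viewR {n} {P} {Q} (B , r) =
    mapPreLR {Rel = RN B} {Rel' = _≈N_} {n = n} {m = n} {g = neg (Pre.co P)} {neg (Pre.co Q)} (B ,_) (bR B r)

  viewN : ∀ {n} {P Q : Neg n} → P ≈N Q → NegLR _≈P_ (negView P) (negView Q)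
  viewN {n} {P} {Q} (B , r) =
    mapNegLR {Rel = RP B} {Rel' = _≈P_} {n = n} {m = n} {g = λ c → pos (Neg.co P)} {λ c → pos (Neg.co Q)}
             (λ _ → refl) (λ c → B ,_) (bN B r)

  BisimSym : ∀ {C D} → Bisim C D → Bisim D C
  BisimSym B = record
    { RP = λ x y → RP B y x ; RR = λ x y → RR B y x ; RN = λ x y → RN B y x
    ; bP = λ r → PosLR-sym (bP B r) ; bR = λ r → PreLR-sym (bR B r) ; bN = λ r → NegLR-sym (bN B r) }

  BisimTrans : ∀ {C D E} → Bisim C D → Bisim D E → Bisim C E
  BisimTrans {C} {D} {E} B₁ B₂ = record
    { RP = Comp {PS C} {PS D} {PS E} {RP B₁} {RP B₂}
    ; RR = Comp {RS C} {RS D} {RS E} {RR B₁} {RR B₂}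
    ; RN = Comp {NS C} {NS D} {NS E} {RN B₁} {RN B₂}
    ; bP = λ { (_ , r₁ , r₂) → PosLR-trans (bP B₁ r₁) (bP B₂ r₂) }
    ; bR = λ { (_ , r₁ , r₂) → PreLR-trans (bR B₁ r₁) (bR B₂ r₂) }
    ; bN = λ { (_ , r₁ , r₂) → NegLR-trans (bN B₁ r₁) (bN B₂ r₂) } }

  ≈P-sym : ∀ {n} {P Q : Pos n} → P ≈P Q → Q ≈P P
  ≈P-sym (B , r) = BisimSym B , r

  ≈P-trans : ∀ {n} {P Q T : Pos n} → P ≈P Q → Q ≈P T → P ≈P T
  ≈P-trans {Q = Q} (B₁ , r₁) (B₂ , r₂) = BisimTrans B₁ B₂ , Pos.st Q , r₁ , r₂

  ≈N-trans : ∀ {n} {P Q T : Neg n} → P ≈N Q → Q ≈N T → P ≈N T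
  ≈N-trans {Q = Q} (B₁ , r₁) (B₂ , r₂) = BisimTrans B₁ B₂ , Neg.st Q , r₁ , r₂

  record Hom (C D : Coalg) : Set₁ where
    field
      hP : ∀ {n} → PS C n → PS D n
      hR : ∀ {n} → RS C n → RS D n
      hN : ∀ {n} → NS C n → NS D n
      eP : ∀ {n} (p : PS C n) → pobs D (hP p) ≡ mapPosL hR (pobs C p)
      eR : ∀ {n} (p : RS C n) → robs D (hR p) ≡ mapPreL hN (robs C p)
      eN : ∀ {n} (p : NS C n) → nobs D (hN p) ≡ mapNegL (λ x → x) (λ c → hP) (nobs C p)
  open Hom public

  data Graph {X Y : ℕ → Set} (h : ∀ {n} → X n → Y n) {n : ℕ} : Y n → X n → Set where
    graph : ∀ {x} → Graph h (h x) x

  HomBisim : ∀ {C D} → Hom C D → Bisim D C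
  HomBisim {C} {D} H = record
    { RP = λ {n} → Graph {PS C} {PS D} (hP H) {n}
    ; RR = λ {n} → Graph {RS C} {RS D} (hR H) {n}
    ; RN = λ {n} → Graph {NS C} {NS D} (hN H) {n}
    ; bP = λ { (graph {p}) → subst (λ l → PosLR (Graph {RS C} {RS D} (hR H)) l (pobs C p)) (sym (eP H p))
                                   (graphPosL (λ _ → graph) (pobs C p)) }
    ; bR = λ { (graph {p}) → subst (λ l → PreLR (Graph {NS C} {NS D} (hN H)) l (robs C p)) (sym (eR H p))
                                   (graphPreL (λ _ → graph) (robs C p)) }
    ; bN = λ { (graph {p}) → subst (λ l → NegLR (Graph {PS C} {PS D} (hP H)) l (nobs C p)) (sym (eN H p))
                                   (graphNegL (λ _ → refl) (λ c _ → graph) (nobs C p)) } }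

  homP : ∀ {C D} (H : Hom C D) {n} (p : PS C n) → pos D (hP H p) ≈P pos C p
  homP H p = HomBisim H , graph

  homN : ∀ {C D} (H : Hom C D) {n} (p : NS C n) → neg D (hN H p) ≈N neg C p
  homN H p = HomBisim H , graph

  idHom : (C : Coalg) → Hom C C
  idHom C = record
    { hP = λ x → x ; hR = λ x → x ; hN = λ x → x
    ; eP = λ p → mapPosL-id (pobs C p) ; eR = λ r → mapPreL-id (robs C r) ; eN = λ s → mapNegL-id (nobs C s) }

  ≈N-refl : ∀ {n} {N : Neg n} → N ≈N N
  ≈N-refl {N = N} = homN (idHom (Neg.co N)) (Neg.st N)

  data SumRel {J : Set} {A B : J → Set} (R : ∀ j → A j → B j → Set) : Σ J A → Σ J B → Set where
    sumRel : ∀ {j x y} → R j x y → SumRel R (j , x) (j , y)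

  SumBisim : ∀ {J : Set} {Cs Ds : J → Coalg} → (∀ j → Bisim (Cs j) (Ds j)) →
             Bisim (SumCo J Cs) (SumCo J Ds)
  SumBisim {J} {Cs} {Ds} Bs = record
    { RP = λ {n} → SumRel {J} {λ j → PS (Cs j) n} {λ j → PS (Ds j) n} (λ j → RP (Bs j))
    ; RR = λ {n} → SumRel {J} {λ j → RS (Cs j) n} {λ j → RS (Ds j) n} (λ j → RR (Bs j))
    ; RN = λ {n} → SumRel {J} {λ j → NS (Cs j) n} {λ j → NS (Ds j) n} (λ j → RN (Bs j))
    ; bP = λ { (sumRel {j} r) → mapPosLR (sumRel {j = j}) (bP (Bs j) r) }
    ; bR = λ { (sumRel {j} r) → mapPreLR (sumRel {j = j}) (bR (Bs j) r) }
    ; bN = λ { (sumRel {j} r) → mapNegLR (λ _ → refl) (λ c → sumRel {j = j}) (bN (Bs j) r) } }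

  liftRen-cong : ∀ {k m} j {ρ ρ' : Fin k → Fin m} → (∀ i → ρ i ≡ ρ' i) →
                 ∀ i → liftRen j ρ i ≡ liftRen j ρ' i
  liftRen-cong {k} j e i with splitAt k i
  ... | inj₁ x = cong (_↑ˡ j) (e x)
  ... | inj₂ y = refl

  data RenRel {X Y : ℕ → Set} (R : ∀ {n} → X n → Y n → Set) {m : ℕ} :
              Σ ℕ (λ k → X k × (Fin k → Fin m)) → Σ ℕ (λ k → Y k × (Fin k → Fin m)) → Set where
    renRel : ∀ {k x y ρ ρ'} → R x y → (∀ i → ρ i ≡ ρ' i) → RenRel R (k , x , ρ) (k , y , ρ')

  data RenVarRel {X Y : ℕ → Set} (R : ∀ {n} → X n → Y n → Set) {m : ℕ} :
                 Σ ℕ (λ k → X k × (Fin k → Fin m)) ⊎ Fin m →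
                 Σ ℕ (λ k → Y k × (Fin k → Fin m)) ⊎ Fin m → Set where
    renState : ∀ {k x y ρ ρ'} → R x y → (∀ i → ρ i ≡ ρ' i) →
               RenVarRel R (inj₁ (k , x , ρ)) (inj₁ (k , y , ρ'))
    sameVar  : ∀ {x} → RenVarRel R (inj₂ x) (inj₂ x)

  VRVBisim : ∀ {D D'} → Bisim D D' → Bisim (VRV D) (VRV D')
  VRVBisim B = record
    { RP = RenRel (RP B) ; RR = RenRel (RR B) ; RN = RenVarRel (RN B)
    ; bP = λ { (renRel r e) → mapPosLR (λ rr → renRel rr e) (bP B r) }
    ; bR = λ { (renRel r e) → mapPreLR (λ rr → renState rr e) (bR B r) }
    ; bN = λ { (renState r e) → mapNegLR e (λ c rr → renRel rr (liftRen-cong (ar c) e)) (bN B r)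
             ; sameVar → varr } }

  module _ {D D' : Coalg} (B : Bisim D D') where
    private VB = VRVBisim B

    wkV-cong : ∀ {m} j {s : NS (VRV D) m} {s'} → RN VB s s' → RN VB (wkV {D} j s) (wkV {D'} j s')
    wkV-cong j (renState r e) = renState r (λ i → cong (_↑ˡ j) (e i))
    wkV-cong j sameVar = sameVar

    liftσ-cong : ∀ {k m} j {σ : Fin k → NS (VRV D) m} {σ'} → (∀ i → RN VB (σ i) (σ' i)) →
                 ∀ i → RN VB (liftσ {D} j σ i) (liftσ {D'} j σ' i)
    liftσ-cong {k} j e i with splitAt k i
    ... | inj₁ x = wkV-cong j (e x)
    ... | inj₂ y = sameVar

  data SubRel {F F' G G' H H' : ℕ → Set} (R : ∀ {k} → F k → F' k → Set)
              (RE : ∀ {m} → G m → G' m → Set) (RH : ∀ {m} → H m → H' m → Set) {m : ℕ} :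
              Σ ℕ (λ k → F k × (Fin k → H m)) ⊎ G m → Σ ℕ (λ k → F' k × (Fin k → H' m)) ⊎ G' m → Set where
    body : ∀ {k x y σ σ'} → R x y → (∀ i → RH (σ i) (σ' i)) →
           SubRel R RE RH (inj₁ (k , x , σ)) (inj₁ (k , y , σ'))
    inside : ∀ {e e'} → RE e e' → SubRel R RE RH (inj₂ e) (inj₂ e')

  module _ {C C' D D' : Coalg} (BC : Bisim C C') (BD : Bisim D D') where
    private
      VB = VRVBisim BD

    SubRP : ∀ {n} → PS (SubCo C D) n → PS (SubCo C' D') n → Set
    SubRP = SubRel {PS C} {PS C'} {PS (VRV D)} {PS (VRV D')} {NS (VRV D)} {NS (VRV D')} (RP BC) (RP VB) (RN VB)

    SubRR : ∀ {n} → RS (SubCo C D) n → RS (SubCo C' D') n → Set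
    SubRR = SubRel {RS C} {RS C'} {RS (VRV D)} {RS (VRV D')} {NS (VRV D)} {NS (VRV D')} (RR BC) (RR VB) (RN VB)

    SubRN : ∀ {n} → NS (SubCo C D) n → NS (SubCo C' D') n → Set
    SubRN = SubRel {NS C} {NS C'} {NS (VRV D)} {NS (VRV D')} {NS (VRV D)} {NS (VRV D')} (RN BC) (RN VB) (RN VB)

    subBisimP : ∀ {n} {p q} → SubRP {n} p q → PosLR SubRR (pobs (SubCo C D) p) (pobs (SubCo C' D') q)
    subBisimP (body r e) = mapPosLR (λ rr → body rr e) (bP BC r)
    subBisimP (inside r) = mapPosLR inside (bP VB r)

    subBisimR : ∀ {n} {p q} → SubRR {n} p q → PreLR SubRN (robs (SubCo C D) p) (robs (SubCo C' D') q)
    subBisimR (body r e) = mapPreLR (λ rr → body rr e) (bR BC r)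
    subBisimR (inside r) = mapPreLR inside (bR VB r)

    subBisimN : ∀ {n} {p q} → SubRN {n} p q → NegLR SubRP (nobs (SubCo C D) p) (nobs (SubCo C' D') q)
    subBisimN (inside r) = mapNegLR (λ _ → refl) (λ c → inside) (bN VB r)
    subBisimN (body {x = x} {y} r e) with nobs C x | nobs C' y | bN BC r
    ... | .(var z) | .(var z) | varr {z} = mapNegLR (λ _ → refl) (λ c → inside) (bN VB (e z))
    ... | .(sum _) | .(sum _) | sumr fs = sumr (λ c → body (fs c) (liftσ-cong BD (ar c) e))

    SubBisim : Bisim (SubCo C D) (SubCo C' D')
    SubBisim = record { RP = SubRP ; RR = SubRR ; RN = SubRN
                      ; bP = subBisimP ; bR = subBisimR ; bN = subBisimN }

  subCong : ∀ {k m} {σ σ' : Fin k → Neg m} {P P' : Pos k} → (∀ i → σ i ≈N σ' i) → P ≈P P' →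
            subPos σ P ≈P subPos σ' P'
  subCong σσ (B , r) = SubBisim B (SumBisim (λ i → proj₁ (σσ i))) ,
                       body r (λ i → renState (sumRel (proj₂ (σσ i))) (λ _ → refl))

  instCong : ∀ {n} b {Ns Ns' : Fin (ar b) → Neg n} → (∀ j → Ns j ≈N Ns' j) →
             ∀ i → instEnv b Ns i ≈N instEnv b Ns' i
  instCong {n} b NN i with splitAt n i
  ... | inj₁ x = ≈N-refl
  ... | inj₂ j = NN j

  mutual
    transNF : ∀ {n} {P Q : Pos n} → NF✠ P → P ≈P Q → NF✠ Q
    transNF {Q = Q} (nf✠ eq h) PQ with inv⋀ (subst (λ l → PosLR _≈R_ l (posView Q)) eq (viewP PQ))
    ... | S' , eq' , rel = nf✠ eq' (λ i → transNFPre (h i) (rel i))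

    transNFPre : ∀ {n} {T T' : Pre n} → NF✠Pre T → T ≈R T' → NF✠Pre T'
    transNFPre {T' = T'} (nf✠cut {b = b} eqT eqh nf) TT'
      with invCut (subst (λ l → PreLR _≈N_ l (preView T')) eqT (viewR TT'))
    ... | h' , Ns' , eqT' , hh' , NN' with invSum (subst (λ l → NegLR _≈P_ l (negView h')) eqh (viewN hh'))
    ... | f' , eqh' , ff' = nf✠cut eqT' eqh' (transNF nf (subCong (instCong b NN') (ff' b)))

  NF✠-resp-≈ : ∀ {n} {P Q : Pos n} → P ≈P Q → NF✠ P ⇔ NF✠ Q
  NF✠-resp-≈ PQ = mk⇔ (λ nf → transNF nf PQ) (λ nf → transNF nf (≈P-sym PQ))

module Constructions (Sg : Signature) where
  open Signature Sg
  open Ludics Sg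
  open Coalg
  open Layers Sg
  open Bisimilarity Sg

  HomSub : ∀ C D → Hom (VRV D) (SubCo C D)
  HomSub C D = record { hP = inj₂ ; hR = inj₂ ; hN = inj₂ ; eP = λ _ → refl ; eR = λ _ → refl ; eN = λ _ → refl }

  HomSum : ∀ J (Cs : J → Coalg) j → Hom (Cs j) (SumCo J Cs)
  HomSum J Cs j = record { hP = j ,_ ; hR = j ,_ ; hN = j ,_ ; eP = λ _ → refl ; eR = λ _ → refl ; eN = λ _ → refl }

  HomRootN : ∀ D n l → Hom D (RootN D n l)
  HomRootN D n l = record
    { hP = λ x → x ; hR = λ x → x ; hN = inj₂
    ; eP = λ p → mapPosL-id (pobs D p) ; eR = λ _ → refl ; eN = λ p → mapNegL-id (nobs D p) }

  liftRen-id : ∀ {m} j {ρ : Fin m → Fin m} → (∀ i → ρ i ≡ i) → ∀ i → liftRen j ρ i ≡ i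
  liftRen-id {m} j {ρ} e i with splitAt m i in eq
  ... | inj₁ x = trans (cong (_↑ˡ j) (e x)) (splitAt⁻¹-↑ˡ eq)
  ... | inj₂ y = splitAt⁻¹-↑ʳ eq

  data IdRen {X : ℕ → Set} {m : ℕ} : Σ ℕ (λ k → X k × (Fin k → Fin m)) → X m → Set where
    idRen : ∀ {x ρ} → (∀ i → ρ i ≡ i) → IdRen (m , x , ρ) x

  data IdRenN {X : ℕ → Set} {m : ℕ} : Σ ℕ (λ k → X k × (Fin k → Fin m)) ⊎ Fin m → X m → Set where
    idRenN : ∀ {x ρ} → (∀ i → ρ i ≡ i) → IdRenN (inj₁ (m , x , ρ)) x

  IdRenBisim : ∀ D → Bisim (VRV D) D
  IdRenBisim D = record
    { RP = IdRen ; RR = IdRen ; RN = IdRenN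
    ; bP = λ { (idRen {x} e) → graphPosL (λ _ → idRen e) (pobs D x) }
    ; bR = λ { (idRen {x} e) → graphPreL (λ _ → idRenN e) (robs D x) }
    ; bN = λ { (idRenN {x} e) → graphNegL e (λ c _ → idRen (liftRen-id (ar c) e)) (nobs D x) } }

  liftσ-undoes : ∀ {E : Coalg} {k m} j {ρ : Fin m → Fin k} {σ : Fin k → NS (VRV E) m} →
                 (∀ x → σ (ρ x) ≡ inj₂ x) → ∀ x → liftσ {E} j σ (liftRen j ρ x) ≡ inj₂ x
  liftσ-undoes {E} {k} {m} j {ρ} {σ} e x with splitAt m x in eq
  ... | inj₁ y rewrite splitAt-↑ˡ k (ρ y) j | e y = cong inj₂ (splitAt⁻¹-↑ˡ eq)
  ... | inj₂ y rewrite splitAt-↑ʳ k j y = cong inj₂ (splitAt⁻¹-↑ʳ eq)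

  module _ (D E : Coalg) where
    data UndoP {m : ℕ} : PS (SubCo (VRV D) E) m → PS D m → Set where
      undoP : ∀ {k x} {ρ : Fin m → Fin k} {σ : Fin k → NS (VRV E) m} → (∀ i → σ (ρ i) ≡ inj₂ i) →
              UndoP (inj₁ (k , (m , x , ρ) , σ)) x
    data UndoR {m : ℕ} : RS (SubCo (VRV D) E) m → RS D m → Set where
      undoR : ∀ {k x} {ρ : Fin m → Fin k} {σ : Fin k → NS (VRV E) m} → (∀ i → σ (ρ i) ≡ inj₂ i) →
              UndoR (inj₁ (k , (m , x , ρ) , σ)) x
    data UndoN {m : ℕ} : NS (SubCo (VRV D) E) m → NS D m → Set where
      undoN : ∀ {k x} {ρ : Fin m → Fin k} {σ : Fin k → NS (VRV E) m} → (∀ i → σ (ρ i) ≡ inj₂ i) →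
              UndoN (inj₁ (k , inj₁ (m , x , ρ) , σ)) x

    private
      undoVar : ∀ {m} {x : Fin m} (t : NS (VRV E) m) → t ≡ inj₂ x →
                NegLR UndoP (mapNegL {P = PS (VRV E)} {P' = PS (SubCo (VRV D) E)} (λ y → y) (λ c → inj₂) (nobs (VRV E) t)) (var x)
      undoVar (inj₂ x) refl = varr

      undoBisimP : ∀ {n} {p q} → UndoP {n} p q → PosLR UndoR (pobs (SubCo (VRV D) E) p) (pobs D q)
      undoBisimP (undoP {x = x} e) with pobs D x
      ... | Ω = Ωr
      ... | ⋀ I S = ⋀r (λ i → undoR e)

      undoBisimR : ∀ {n} {p q} → UndoR {n} p q → PreLR UndoN (robs (SubCo (VRV D) E) p) (robs D q)
      undoBisimR (undoR {x = x} e) with robs D x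
      ... | cut h b Ns = cutr (undoN e) (λ j → undoN e)

      undoBisimN : ∀ {n} {p q} → UndoN {n} p q → NegLR UndoP (nobs (SubCo (VRV D) E) p) (nobs D q)
      undoBisimN (undoN {x = x} {ρ} {σ} e) with nobs D x
      ... | var y = undoVar (σ (ρ y)) (e y)
      ... | sum f = sumr (λ c → undoP {ρ = liftRen (ar c) ρ} {σ = liftσ {E} (ar c) σ}
                                       (liftσ-undoes {E} (ar c) {ρ = ρ} {σ = σ} e))

    UndoBisim : Bisim (SubCo (VRV D) E) D
    UndoBisim = record { RP = UndoP ; RR = UndoR ; RN = UndoN ; bP = undoBisimP ; bR = undoBisimR ; bN = undoBisimN }

  undoRenaming : ∀ {D E k m x} {ρ : Fin m → Fin k} {σ : Fin k → NS (VRV E) m} → (∀ i → σ (ρ i) ≡ inj₂ i) →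
                 neg (SubCo (VRV D) E) (inj₁ (k , inj₁ (m , x , ρ) , σ)) ≈N neg D x
  undoRenaming {D} {E} e = UndoBisim D E , undoN e

  subState-cong : ∀ {C C' E k m} {c : NS C k} {c' : NS C' k} {σ : Fin k → NS (VRV E) m} →
                  neg C c ≈N neg C' c' →
                  neg (SubCo C E) (inj₁ (k , c , σ)) ≈N neg (SubCo C' E) (inj₁ (k , c' , σ))
  subState-cong {E = E} {σ = σ} (B , r) = SubBisim B (HomBisim (idHom E)) , body r (λ i → envRefl (σ i))
    where
      envRefl : ∀ {m} (s : NS (VRV E) m) → RN (VRVBisim (HomBisim (idHom E))) s s
      envRefl (inj₁ (k , s , ρ)) = renState graph (λ _ → refl)
      envRefl (inj₂ x) = sameVar

module Interaction (Sg : Signature) where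
  open Signature Sg
  open Ludics Sg
  open Coalg
  open Bisimilarity Sg
  open Constructions Sg

  HomHead : ∀ (a : Name) (Ks : Fin (ar a) → Neg 0) (j : Fin (ar a)) →
            Hom (VRV (Neg.co (Ks j))) (Pos.co (headAt a Ks))
  HomHead a Ks j = record
    { hP = λ p → inj₂ (tt , just j , p) ; hR = λ r → tt , inj₂ (just j , r) ; hN = λ s → tt , just j , s
    ; eP = eP' ; eR = eR' ; eN = eN' }
    where
      D = VRV (Neg.co (Ks j))
      H = Pos.co (headAt a Ks)
      eP' : ∀ {n} (p : PS D n) → pobs H (inj₂ (tt , just j , p)) ≡ mapPosL (λ r → tt , inj₂ (just j , r)) (pobs D p)
      eP' p with pobs D p
      ... | Ω = refl
      ... | ⋀ I S = refl
      eR' : ∀ {n} (p : RS D n) → robs H (tt , inj₂ (just j , p)) ≡ mapPreL (λ s → tt , just j , s) (robs D p)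
      eR' p with robs D p
      ... | cut h b Ns = refl
      eN' : ∀ {n} (p : NS D n) → nobs H (tt , just j , p) ≡ mapNegL (λ x → x) (λ c p → inj₂ (tt , just j , p)) (nobs D p)
      eN' p with nobs D p
      ... | var x = refl
      ... | sum g = refl

  -- In the reduct of x₀ | ā⟨K⃗⟩ against N = Σ a(x⃗).P_a, the body is P_a
  -- seen through several embeddings (substitution, identity renaming, sum,
  -- root, sum); composing the corresponding bisimulations gives P_a.
  bodyBisim : ∀ (f : (a : Name) → Pos (0 + ar a)) a {C : Coalg} →
              pos (SubCo C (SumCo (Fin 1) (λ _ → Neg.co (consNeg (sum f)))))
                  (inj₂ (0 + ar a , (zero , (a , Pos.st (f a))) , liftRen (ar a) (λ x → x))) ≈P f a
  bodyBisim f a {C} =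
    ≈P-trans (homP (HomSub C Nsum) _)
    (≈P-trans (IdRenBisim _ , idRen (liftRen-id (ar a) (λ _ → refl)))
    (≈P-trans (homP (HomSum (Fin 1) (λ _ → Neg.co (consNeg (sum f))) zero) _)
    (≈P-trans (homP (HomRootN Body 0 (sum (λ a → a , Pos.st (f a)))) _)
              (homP (HomSum Name (λ a → Pos.co (f a)) a) _))))
    where
      Nsum = SumCo (Fin 1) (λ _ → Neg.co (consNeg (sum f)))
      Body = SumCo Name (λ a → Pos.co (f a))

  redexStep : ∀ {n} {P : Pos n} {T : Pre n} {h : Neg n} {b : Name} {Ns : Fin (ar b) → Neg n}
                {g : (a : Name) → Pos (n + ar a)} →
              posView P ≡ ⋀ ⊤ (λ _ → T) → preView T ≡ cut h b Ns → negView h ≡ sum g →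
              NF✠ P ⇔ NF✠ (subPos (instEnv b Ns) (g b))
  redexStep {P = P} {T} {h} {b} {Ns} {g} eqP eqT eqh = mk⇔ reduce (λ nf → nf✠ eqP (λ _ → nf✠cut eqT eqh nf))
    where
      reducePre : NF✠Pre T → NF✠ (subPos (instEnv b Ns) (g b))
      reducePre (nf✠cut eqT' eqh' nf) with trans (sym eqT) eqT'
      ... | refl with trans (sym eqh) eqh'
      ... | refl = nf

      reduce : NF✠ P → NF✠ (subPos (instEnv b Ns) (g b))
      reduce (nf✠ eqP' conjuncts) with trans (sym eqP) eqP'
      ... | refl = reducePre (conjuncts tt)

  -- Interaction of a head with a sum: x₀ | ā⟨K⃗⟩ ⊥ Σ a(x⃗).P_a iff
  -- [[P_a[K⃗/x⃗]]] = ✠; the cut reduces in one step to a design bisimilar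
  -- to P_a[K⃗/x⃗].
  headInteraction : (f : (a : Name) → Pos (0 + ar a)) (a : Name) (Ks : Fin (ar a) → Neg 0) →
                    headAt a Ks ⊥ᴰ consNeg (sum f) ⇔ NF✠ (subPos Ks (f a))
  headInteraction f a Ks =
    ⇔-trans (redexStep refl refl refl)
            (NF✠-resp-≈ (subCong (λ j → ≈N-trans (subState-cong (homN (HomHead a Ks j) _)) (undoRenaming (λ ())))
                                 (bodyBisim f a)))

module Standardness (Sg : Signature) where
  open Signature Sg
  open Ludics Sg
  open Coalg
  open GenInv
  open Bisimilarity Sg using (Hom; hP; hR; hN; eP; eR; eN)
  open Constructions Sg using (HomSum; HomRootN)

  module _ {a b} {R : ℕ → Set a} {T : ℕ → Set b} {n m} {ρ : Fin n → Fin m}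
           {g : ∀ c → R (n + ar c) → T (m + ar c)} where
    isVar-map : (l : NegL R n) → IsVarL l → IsVarL (mapNegL {P = R} {P' = T} ρ g l)
    isVar-map (var x) _ = tt

    isVar-unmap : (l : NegL R n) → IsVarL (mapNegL {P = R} {P' = T} ρ g l) → IsVarL l
    isVar-unmap (var x) _ = tt

  module _ {C C' : Coalg} where
    posOK-map : ∀ {n n'} {I : ∀ {m} → RS C m → Set} {I' : ∀ {m} → RS C' m → Set} {g : RS C n → RS C' n'} →
                (∀ {r} → I r → I' (g r)) → (l : PosL (RS C) n) → PosOK C I l → PosOK C' I' (mapPosL g l)
    posOK-map gI Ω _ = tt
    posOK-map gI (⋀ J S) ok = λ i → gI (ok i)

    preOK-map : ∀ {n n'} {I : ∀ {m} → NS C m → Set} {I' : ∀ {m} → NS C' m → Set} {g : NS C n → NS C' n'} →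
                (∀ h → IsVarL (nobs C h) → IsVarL (nobs C' (g h))) → (∀ {s} → I s → I' (g s)) →
                (l : PreL (NS C) n) → PreOK C I l → PreOK C' I' (mapPreL g l)
    preOK-map gV gI (cut h b Ns) (v , ok) = gV h v , λ j → gI (ok j)

    negOK-map : ∀ {n m} {I : ∀ {k} → PS C k → Set} {I' : ∀ {k} → PS C' k → Set} {ρ : Fin n → Fin m}
                {g : ∀ c → PS C (n + ar c) → PS C' (m + ar c)} →
                (∀ c {p} → I p → I' (g c p)) → (l : NegL (PS C) n) → NegOK C I l → NegOK C' I' (mapNegL ρ g l)
    negOK-map gI (sum f) ok = λ c → gI c (ok c)

    posOK-pull : ∀ {n} {I : ∀ {m} → RS C m → Set} {I' : ∀ {m} → RS C' m → Set} {g : RS C n → RS C' n} →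
                 (∀ {r} → I' (g r) → I r) → (l : PosL (RS C) n) → PosOK C' I' (mapPosL g l) → PosOK C I l
    posOK-pull gI Ω _ = tt
    posOK-pull gI (⋀ J S) ok = λ i → gI (ok i)

    preOK-pull : ∀ {n} {I : ∀ {m} → NS C m → Set} {I' : ∀ {m} → NS C' m → Set} {g : NS C n → NS C' n} →
                 (∀ h → IsVarL (nobs C' (g h)) → IsVarL (nobs C h)) → (∀ {s} → I' (g s) → I s) →
                 (l : PreL (NS C) n) → PreOK C' I' (mapPreL g l) → PreOK C I l
    preOK-pull gV gI (cut h b Ns) (v , ok) = gV h v , λ j → gI (ok j)

    negOK-pull : ∀ {n} {I : ∀ {k} → PS C k → Set} {I' : ∀ {k} → PS C' k → Set}
                 {g : ∀ c → PS C (n + ar c) → PS C' (n + ar c)} →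
                 (∀ c {p} → I' (g c p) → I p) → (l : NegL (PS C) n) → NegOK C' I' (mapNegL (λ x → x) g l) → NegOK C I l
    negOK-pull gI (var x) ()
    negOK-pull gI (sum f) ok = λ c → gI c (ok c)

  HomInv : ∀ {C D} → Hom C D → GenInv D → GenInv C
  HomInv {C} {D} H inv = record
    { Ip = λ p → Ip inv (hP H p) ; Ir = λ r → Ir inv (hR H r) ; In = λ s → In inv (hN H s)
    ; closedP = λ {_} {p} ip → posOK-pull (λ x → x) (pobs C p) (subst (PosOK D (Ir inv)) (eP H p) (closedP inv ip))
    ; closedR = λ {_} {r} ir → preOK-pull isVar-back (λ x → x) (robs C r) (subst (PreOK D (In inv)) (eR H r) (closedR inv ir))
    ; closedN = λ {_} {s} is → negOK-pull (λ c x → x) (nobs C s) (subst (NegOK D (Ip inv)) (eN H s) (closedN inv is)) }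
    where
      isVar-back : ∀ {n} (h : NS C n) → IsVarL (nobs D (hN H h)) → IsVarL (nobs C h)
      isVar-back h v = isVar-unmap (nobs C h) (subst IsVarL (eN H h) v)

  emptyInv : (C : Coalg) → GenInv C
  emptyInv C = record { Ip = λ _ → ⊥ ; Ir = λ _ → ⊥ ; In = λ _ → ⊥
                      ; closedP = λ () ; closedR = λ () ; closedN = λ () }

  sumInv : ∀ {J} {Cs : J → Coalg} → (∀ j → GenInv (Cs j)) → GenInv (SumCo J Cs)
  sumInv {J} {Cs} invs = record
    { Ip = λ { (j , p) → Ip (invs j) p } ; Ir = λ { (j , r) → Ir (invs j) r } ; In = λ { (j , s) → In (invs j) s }
    ; closedP = λ { {p = j , p} ip → posOK-map (λ x → x) (pobs (Cs j) p) (closedP (invs j) ip) }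
    ; closedR = λ { {r = j , r} ir → preOK-map (λ h → isVar-map (nobs (Cs j) h)) (λ x → x)
                                                (robs (Cs j) r) (closedR (invs j) ir) }
    ; closedN = λ { {s = j , s} is → negOK-map (λ c x → x) (nobs (Cs j) s) (closedN (invs j) is) } }

  -- The other states keep their closure proofs; where their
  -- layer is not re-mapped, the proof is re-read by inspecting the layer.
  rootPInv : ∀ {D n l} (inv : GenInv D) → PosOK (RootP D n l) (Ir inv) l → GenInv (RootP D n l)
  rootPInv {D} {n} {l} inv ok = record
    { Ip = λ { (inj₁ _) → ⊤ ; (inj₂ p) → Ip inv p } ; Ir = Ir inv ; In = In inv
    ; closedP = λ { {p = inj₁ refl} _ → ok ; {p = inj₂ p} ip → keepP (pobs D p) (closedP inv ip) }
    ; closedR = λ {_} {r} ir → keepR (robs D r) (closedR inv ir)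
    ; closedN = λ {_} {s} is → negOK-map (λ c x → x) (nobs D s) (closedN inv is) }
    where
      keepP : ∀ {m} (l' : PosL (RS D) m) → PosOK D (Ir inv) l' → PosOK (RootP D n l) (Ir inv) l'
      keepP Ω _ = tt
      keepP (⋀ J S) ok' = ok'
      keepR : ∀ {m} (l' : PreL (NS D) m) → PreOK D (In inv) l' → PreOK (RootP D n l) (In inv) l'
      keepR (cut h b Ns) (v , ok') = isVar-map (nobs D h) v , ok'

  rootRInv : ∀ {D n l} (inv : GenInv D) → PreOK (RootR D n l) (In inv) l → GenInv (RootR D n l)
  rootRInv {D} {n} {l} inv ok = record
    { Ip = Ip inv ; Ir = λ { (inj₁ _) → ⊤ ; (inj₂ r) → Ir inv r } ; In = In inv
    ; closedP = λ {_} {p} ip → posOK-map (λ x → x) (pobs D p) (closedP inv ip)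
    ; closedR = λ { {r = inj₁ refl} _ → ok ; {r = inj₂ r} ir → keepR (robs D r) (closedR inv ir) }
    ; closedN = λ {_} {s} is → keepN (nobs D s) (closedN inv is) }
    where
      keepR : ∀ {m} (l' : PreL (NS D) m) → PreOK D (In inv) l' → PreOK (RootR D n l) (In inv) l'
      keepR (cut h b Ns) ok' = ok'
      keepN : ∀ {m} (l' : NegL (PS D) m) → NegOK D (Ip inv) l' → NegOK (RootR D n l) (Ip inv) l'
      keepN (sum f) ok' = ok'

  rootNInv : ∀ {D n l} (inv : GenInv D) → NegOK (RootN D n l) (Ip inv) l → GenInv (RootN D n l)
  rootNInv {D} {n} {l} inv ok = record
    { Ip = Ip inv ; Ir = Ir inv ; In = λ { (inj₁ _) → ⊤ ; (inj₂ s) → In inv s }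
    ; closedP = λ {_} {p} ip → keepP (pobs D p) (closedP inv ip)
    ; closedR = λ {_} {r} ir → preOK-map (λ h v → v) (λ x → x) (robs D r) (closedR inv ir)
    ; closedN = λ { {s = inj₁ refl} _ → ok ; {s = inj₂ s} is → keepN (nobs D s) (closedN inv is) } }
    where
      keepP : ∀ {m} (l' : PosL (RS D) m) → PosOK D (Ir inv) l' → PosOK (RootN D n l) (Ir inv) l'
      keepP Ω _ = tt
      keepP (⋀ J S) ok' = ok'
      keepN : ∀ {m} (l' : NegL (PS D) m) → NegOK D (Ip inv) l' → NegOK (RootN D n l) (Ip inv) l'
      keepN (sum f) ok' = ok'

  renamingInv : ∀ {D} → GenInv D → GenInv (VRV D)
  renamingInv {D} inv = record
    { Ip = λ { (_ , p , _) → Ip inv p } ; Ir = λ { (_ , r , _) → Ir inv r }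
    ; In = λ { (inj₁ (_ , s , _)) → In inv s ; (inj₂ _) → ⊥ }
    ; closedP = λ { {p = _ , p , _} ip → posOK-map (λ x → x) (pobs D p) (closedP inv ip) }
    ; closedR = λ { {r = _ , r , _} ir → preOK-map (λ h → isVar-map (nobs D h)) (λ x → x) (robs D r) (closedR inv ir) }
    ; closedN = λ { {s = inj₁ (_ , s , _)} is → negOK-map (λ c x → x) (nobs D s) (closedN inv is) } }

  GenPre : ∀ {n} → Pre n → Set₁
  GenPre T = Σ (GenInv (Pre.co T)) λ inv → Ir inv (Pre.st T)

  consPosGen : ∀ {n} {I : Set} {S : I → Pre n} → (∀ i → GenPre (S i)) → GenPos (consPos (⋀ I S))
  consPosGen gs = rootPInv (sumInv (λ i → proj₁ (gs i))) (λ i → proj₂ (gs i)) , tt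

  consPreGen : ∀ {n} {h : Neg n} {b : Name} {Ns : Fin (ar b) → Neg n} → IsVarL (negView h) →
               (∀ j → GenNeg (Ns j)) → GenPre (consPre (cut h b Ns))
  consPreGen {h = h} {b} {Ns} hv gs =
    rootRInv (sumInv λ { nothing → emptyInv (Neg.co h) ; (just j) → proj₁ (gs j) })
             (isVar-map (nobs (Neg.co h) (Neg.st h)) (isVar-unmap _ hv) , λ j → proj₂ (gs j)) , tt

  consNegGen : ∀ {n} {f : (a : Name) → Pos (n + ar a)} → (∀ a → GenPos (f a)) → GenNeg (consNeg (sum f))
  consNegGen gs = rootNInv (sumInv (λ a → proj₁ (gs a))) (λ a → proj₂ (gs a)) , tt

  renGen : ∀ {k m} (ρ : Fin k → Fin m) {N : Neg k} → GenNeg N → GenNeg (renNeg ρ N)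
  renGen ρ (inv , is) = renamingInv inv , is

  sumBodyGen : ∀ {f : (a : Name) → Pos (0 + ar a)} → GenNeg (consNeg (sum f)) → ∀ a → GenPos (f a)
  sumBodyGen {f} (inv , is) a =
    HomInv (HomSum Name (λ a → Pos.co (f a)) a)
           (HomInv (HomRootN (SumCo Name (λ a → Pos.co (f a))) 0 (sum (λ a → a , Pos.st (f a)))) inv) ,
    closedN inv is a

  headAtomic : ∀ a (Ks : Fin (ar a) → Neg 0) → (∀ j → AtomicNeg (Ks j)) → AtomicPos (headAt a Ks)
  headAtomic a Ks atomic = (λ ()) , consPosGen (λ _ → consPreGen tt (λ j → renGen (λ ()) (atomic j)))

module Daimon (Sg : Signature) where
  open Ludics Sg
  open Coalg
  open GenInv
  open Standardness Sg using (consNegGen; consPosGen)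

  daimon : Neg 0
  daimon = consNeg (sum (λ a → consPos (⋀ ⊥ (λ ()))))

  daimonAtomic : AtomicNeg daimon
  daimonAtomic = consNegGen (λ a → consPosGen (λ ()))

  -- Substituting the daimon for every free variable of a standard design
  -- gives ✠: every conjunct x | ā⟨N⃗⟩ becomes a redex whose reduct is ✠.
  module _ {k : ℕ} (C : Coalg) (inv : GenInv C) where
    private
      E = SumCo (Fin k) (λ _ → Neg.co daimon)
      SC = SubCo C E
      env : Fin k → NS (VRV E) 0
      env i = inj₁ (0 , (i , Neg.st daimon) , λ x → x)

      headView : (h : NS C k) (x : Fin k) → nobs C h ≡ var x →
                 negView (neg SC (inj₁ (k , h , env))) ≡
                 mapNegL {P = PS SC} {P' = Pos} (λ y → y) (λ a → pos SC)
                         (mapNegL {P = PS (VRV E)} {P' = PS SC} (λ y → y) (λ a → inj₂) (nobs (VRV E) (env x)))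
      headView h x eq rewrite eq = refl

      conjunct : (r : RS C k) → Ir inv r → NF✠Pre (pre SC (inj₁ (k , r , env)))
      conjunct r ir with robs C r in eqr | closedR inv ir
      ... | cut h b Ns | (headIsVar , _) with nobs C h in eqh | headIsVar
      ... | sum _ | ()
      ... | var x | _ = nf✠cut (cong (λ l → mapPreL {N = NS SC} {N' = Neg} (neg SC)
                                               (mapPreL {N = NS C} {N' = NS SC} (λ s → inj₁ (k , s , env)) l)) eqr)
                           (headView h x eqh) (nf✠ refl (λ ()))

    daimonSubst : (p : PS C k) → Ip inv p → ¬ IsΩL (posView (pos C p)) → NF✠ (subPos (λ _ → daimon) (pos C p))
    daimonSubst p ip notΩ with pobs C p in eqp | closedP inv ip | notΩ
    ... | Ω | _ | notΩ' = ⊥-elim (notΩ' tt)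
    ... | ⋀ I S | conjuncts | _ =
      nf✠ (cong (λ l → mapPosL {R = RS SC} {R' = Pre} (pre SC) (mapPosL {R = RS C} {R' = RS SC} (λ r → inj₁ (k , r , env)) l)) eqp)
          (λ i → conjunct (S i) (conjuncts i))

  daimonOrth : (P : Pos 1) → AtomicPos P → P ⊥ᴰ daimon
  daimonOrth (pos C p) (notΩ , inv , ip) = daimonSubst C inv p ip notΩ

  nf✠-notΩ : ∀ {k m} {σ : Fin k → Neg m} (P : Pos k) → NF✠ (subPos σ P) → ¬ IsΩL (posView P)
  nf✠-notΩ (pos C p) (nf✠ eq _) with pobs C p | eq
  ... | Ω | ()
  ... | ⋀ I S | _ = λ ()

module Orthogonality (Sg : Signature) where
  open Ludics Sg
  open Daimon Sg using (daimon; daimonAtomic; daimonOrth)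

  ⊆-biorth : {X : PSet} {P : Pos 1} → AtomicPos P → X P → ((X ^⊥ₚ) ^⊥ₙ) P
  ⊆-biorth atomic P∈X = atomic , λ N N∈X⊥ → proj₂ N∈X⊥ _ P∈X

  ⊥-⊆-triorth : {X : PSet} {N : Neg 0} → (X ^⊥ₚ) N → (((X ^⊥ₚ) ^⊥ₙ) ^⊥ₚ) N
  ⊥-⊆-triorth N∈X⊥ = proj₁ N∈X⊥ , λ P P∈X⊥⊥ → proj₂ P∈X⊥⊥ _ N∈X⊥

  -- The daimon belongs to the orthogonal of every positive behaviour, whose
  -- elements are all atomic.
  daimon∈⊥ : {X : PSet} → IsPosBehaviour X → (X ^⊥ₚ) daimon
  daimon∈⊥ behaviour = daimonAtomic , λ P P∈X → daimonOrth P (proj₁ (Equivalence.from (behaviour P) P∈X))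

-- Theorem 2.17.  Necessity: each head ā⟨K⃗⟩ with K⃗ ∈ P⃗^⊥ lies in the union
-- defining ᾱ⟨P⃗^⊥⟩, so it is orthogonal to N, i.e. P_a[K⃗/x⃗] normalises to ✠;
-- taking K⃗ = daimons shows P_a ≠ Ω.  Sufficiency: by the same interaction
-- lemma N is orthogonal to the union, and X^⊥ ⊆ X^⊥⊥⊥.
theorem2p17 : (Sg : Signature) →
    let open Signature Sg
        open Ludics Sg
    in (α : Connective) →
       (Pb : Fin (Connective.arity α) → PSet) →
       (∀ i → IsPosBehaviour (Pb i)) →
       (f : (a : Name) → Pos (0 + ar a)) →
       AtomicNeg (consNeg (sum f)) →
       α⟪ α ⟫ Pb (consNeg (sum f))
         ⇔ (∀ (ac : Action (Connective.arity α)) → ac ∈ Connective.actions α →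
              f (Action.name ac) ⊨ (λ j → Pb (Action.args ac j)))
theorem2p17 Sg α Pb behaviours f atomicN = mk⇔ necessary sufficient
  where
    open Ludics Sg
    open Interaction Sg using (headInteraction)
    open Standardness Sg using (sumBodyGen; headAtomic)
    open Daimon Sg using (daimon; nf✠-notΩ)
    open Orthogonality Sg

    Typed : Action (Connective.arity α) → Set₁
    Typed ac = f (Action.name ac) ⊨ (λ j → Pb (Action.args ac j))

    necessary : α⟪ α ⟫ Pb (consNeg (sum f)) → ∀ ac → ac ∈ Connective.actions α → Typed ac
    necessary (_ , orth) (act a args _) ac∈α = (notΩ , sumBodyGen atomicN a) , bodyNF
      where
        bodyNF : ∀ Ks → (∀ j → (Pb (args j) ^⊥ₚ) (Ks j)) → NF✠ (subPos Ks (f a))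
        bodyNF Ks Ks∈ = Equivalence.to (headInteraction f a Ks)
          (orth (headAt a Ks) (⊆-biorth (headAtomic a Ks (λ j → proj₁ (Ks∈ j))) (_ , ac∈α , Ks , Ks∈ , refl)))
        notΩ : ¬ IsΩL (posView (f a))
        notΩ = nf✠-notΩ (f a) (bodyNF (λ _ → daimon) (λ j → daimon∈⊥ (behaviours (args j))))

    sufficient : (∀ ac → ac ∈ Connective.actions α → Typed ac) → α⟪ α ⟫ Pb (consNeg (sum f))
    sufficient typed = ⊥-⊆-triorth (atomicN , λ { _ (ac , ac∈α , Ks , Ks∈ , refl) →
      Equivalence.from (headInteraction f (Action.name ac) Ks) (proj₂ (typed ac ac∈α) Ks Ks∈) })
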